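{- Let $\ell, k, s_1, \ldots, s_\ell$ be positive integers satisfying $\sum_{i=1}^{\ell} s_i \ge k + \ell$. Then there exist a positive integer $s$ and non-negative integers $\sigma_1, \ldots, \sigma_\ell$ such that $\sigma_i s \le s_i$ for every $i \in [\ell]$, $\sum_{i=1}^{\ell} \sigma_i = k$, and $\sum_{i=1}^{\ell} s_i - sk \le \frac{\ell}{k}\sum_{i=1}^{\ell} s_i + k$. -}

module Defs where

open import Data.Nat using (ℕ; zero; suc; _+_)
open import Data.Fin using (Fin; zero; suc)

sumFin : (n : ℕ) → (Fin n → ℕ) → ℕ
sumFin zero    f = 0
sumFin (suc n) f = f zero + sumFin n (λ i → f (suc i))

-- Let s be the largest integer with Σᵢ ⌊sᵢ/s⌋ ≥ k (it exists because s = 1 works by hypothesis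
-- and s > S := Σᵢ sᵢ does not), and pick σᵢ ≤ ⌊sᵢ/s⌋ with Σᵢ σᵢ = k.  Then sk ≤ S, while the
-- maximality of s gives Σᵢ ⌊sᵢ/(s+1)⌋ < k and so, since sᵢ ≤ (s+1)⌊sᵢ/(s+1)⌋ + s,
-- S ≤ k(s+1) + ℓs.  Hence S − sk ≤ k + ℓs, and multiplying by k and using ks ≤ S gives
-- k(S − sk) ≤ k² + ℓS.
module Submission where

open import Defs
open import Data.Nat using (ℕ; _+_; _*_; _≤_; _≥_; _>_)
open import Data.Fin using (Fin)
open import Data.Product using (Σ; _×_)
open import Relation.Binary.PropositionalEquality using (_≡_)
open import Data.Integer as ℤ using (ℤ; +_)

open import Data.Nat using (zero; suc; _<_; _∸_; _⊓_; z≤n; s≤s; s≤s⁻¹; _≤?_; _/_; _%_; >-nonZero)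
open import Data.Nat.Properties
open import Data.Nat.DivMod using (n/1≡n; m/n*n≤m; m≡m%n+[m/n]*n; m%n<n)
open import Data.Nat.Tactic.RingSolver using (solve-∀)
open import Data.Fin using (zero; suc)
open import Data.Product using (∃; _,_)
open import Data.Empty using (⊥-elim)
open import Relation.Nullary using (¬_; yes; no)
open import Relation.Unary using (Pred; Decidable)
open import Relation.Binary.PropositionalEquality using (refl; sym; cong; cong₂; module ≡-Reasoning)
import Data.Integer.Properties as ℤ

sumFin-mono-≤ : ∀ n {f g : Fin n → ℕ} → (∀ i → f i ≤ g i) → sumFin n f ≤ sumFin n g
sumFin-mono-≤ zero    f≤g = z≤n
sumFin-mono-≤ (suc n) f≤g = +-mono-≤ (f≤g zero) (sumFin-mono-≤ n (λ i → f≤g (suc i)))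

sumFin-distrib-+ : ∀ n (f g : Fin n → ℕ) →
                   sumFin n (λ i → f i + g i) ≡ sumFin n f + sumFin n g
sumFin-distrib-+ zero    f g = refl
sumFin-distrib-+ (suc n) f g = begin
  f zero + g zero + sumFin n (λ i → f (suc i) + g (suc i))
    ≡⟨ cong (_+_ (f zero + g zero)) (sumFin-distrib-+ n (λ i → f (suc i)) (λ i → g (suc i))) ⟩
  f zero + g zero + (sumFin n (λ i → f (suc i)) + sumFin n (λ i → g (suc i)))
    ≡⟨ +-+-comm (f zero) (g zero) _ _ ⟩
  f zero + sumFin n (λ i → f (suc i)) + (g zero + sumFin n (λ i → g (suc i))) ∎
  where
  open ≡-Reasoning
  +-+-comm : ∀ a b c d → a + b + (c + d) ≡ a + c + (b + d)
  +-+-comm = solve-∀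

sumFin-distribʳ-* : ∀ n (f : Fin n → ℕ) c → sumFin n (λ i → f i * c) ≡ sumFin n f * c
sumFin-distribʳ-* zero    f c = refl
sumFin-distribʳ-* (suc n) f c = begin
  f zero * c + sumFin n (λ i → f (suc i) * c) ≡⟨ cong (_+_ (f zero * c)) (sumFin-distribʳ-* n (λ i → f (suc i)) c) ⟩
  f zero * c + sumFin n (λ i → f (suc i)) * c ≡⟨ *-distribʳ-+ c (f zero) _ ⟨
  (f zero + sumFin n (λ i → f (suc i))) * c   ∎
  where open ≡-Reasoning

sumFin-const : ∀ n c → sumFin n (λ _ → c) ≡ n * c
sumFin-const zero    c = refl
sumFin-const (suc n) c = cong (_+_ c) (sumFin-const n c)

sumFin-select : ∀ n (f : Fin n → ℕ) k → k ≤ sumFin n f →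
                ∃ λ (σ : Fin n → ℕ) → (∀ i → σ i ≤ f i) × sumFin n σ ≡ k
sumFin-select zero    f zero    _ = (λ ()) , (λ ()) , refl
sumFin-select (suc n) f k k≤Σf
  with sumFin-select n (λ i → f (suc i)) (k ∸ f zero) (m≤n+o⇒m∸n≤o k (f zero) k≤Σf)
... | τ , τ≤f , Στ≡k∸f₀ = σ , σ≤f , Σσ≡k
  where
  σ : Fin (suc n) → ℕ
  σ zero    = f zero ⊓ k
  σ (suc i) = τ i

  σ≤f : ∀ i → σ i ≤ f i
  σ≤f zero    = m⊓n≤m (f zero) k
  σ≤f (suc i) = τ≤f i

  Σσ≡k : sumFin (suc n) σ ≡ k
  Σσ≡k = begin
    f zero ⊓ k + sumFin n τ     ≡⟨ cong (_+_ (f zero ⊓ k)) Στ≡k∸f₀ ⟩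
    f zero ⊓ k + (k ∸ f zero)   ≡⟨ m⊓n+n∸m≡n (f zero) k ⟩
    k                           ∎
    where open ≡-Reasoning

last-before-failure : ∀ {p} {P : Pred ℕ p} → Decidable P → P 0 → ∀ n → ¬ P n →
                      ∃ λ t → P t × ¬ P (suc t)
last-before-failure P? P0 zero    ¬Pn = ⊥-elim (¬Pn P0)
last-before-failure P? P0 (suc n) ¬P1+n with P? n
... | yes Pn = n , Pn , ¬P1+n
... | no ¬Pn = last-before-failure P? P0 n ¬Pn

m≤[m/1+t]*[1+t]+t : ∀ m t → m ≤ m / suc t * suc t + t
m≤[m/1+t]*[1+t]+t m t = begin
  m                             ≡⟨ m≡m%n+[m/n]*n m (suc t) ⟩
  m % suc t + m / suc t * suc t ≤⟨ +-monoˡ-≤ _ (s≤s⁻¹ (m%n<n m (suc t))) ⟩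
  t + m / suc t * suc t         ≡⟨ +-comm t _ ⟩
  m / suc t * suc t + t         ∎
  where open ≤-Reasoning

k*[S∸s*k]≤ℓ*S+k*k : ∀ ℓ k s S → s * k ≤ S → S ≤ k * suc s + ℓ * s → k * (S ∸ s * k) ≤ ℓ * S + k * k
k*[S∸s*k]≤ℓ*S+k*k ℓ k s S sk≤S S≤k[1+s]+ℓs = begin
  k * (S ∸ s * k)        ≤⟨ *-monoʳ-≤ k (m≤n+o⇒m∸n≤o S (s * k) S≤sk+[k+ℓs]) ⟩
  k * (k + ℓ * s)        ≡⟨ k[k+ℓs]≡ℓ[sk]+kk ℓ k s ⟩
  ℓ * (s * k) + k * k    ≤⟨ +-monoˡ-≤ (k * k) (*-monoʳ-≤ ℓ sk≤S) ⟩
  ℓ * S + k * k          ∎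
  where
  open ≤-Reasoning
  k[1+s]+ℓs≡sk+[k+ℓs] : ∀ ℓ k s → k * suc s + ℓ * s ≡ s * k + (k + ℓ * s)
  k[1+s]+ℓs≡sk+[k+ℓs] = solve-∀
  S≤sk+[k+ℓs] : S ≤ s * k + (k + ℓ * s)
  S≤sk+[k+ℓs] = ≤-trans S≤k[1+s]+ℓs (≤-reflexive (k[1+s]+ℓs≡sk+[k+ℓs] ℓ k s))
  k[k+ℓs]≡ℓ[sk]+kk : ∀ ℓ k s → k * (k + ℓ * s) ≡ ℓ * (s * k) + k * k
  k[k+ℓs]≡ℓ[sk]+kk = solve-∀

+*[+-+]≡+[*∸] : ∀ k {m n} → n ≤ m → (+ k) ℤ.* ((+ m) ℤ.- (+ n)) ≡ + (k * (m ∸ n))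
+*[+-+]≡+[*∸] k {m} {n} n≤m = begin
  + k ℤ.* (+ m ℤ.- + n)  ≡⟨ cong (+ k ℤ.*_) (ℤ.m-n≡m⊖n m n) ⟩
  + k ℤ.* (m ℤ.⊖ n)      ≡⟨ cong (+ k ℤ.*_) (ℤ.⊖-≥ n≤m) ⟩
  + k ℤ.* + (m ∸ n)      ≡⟨ ℤ.pos-* k (m ∸ n) ⟨
  + (k * (m ∸ n))        ∎
  where open ≡-Reasoning

-- Indexed by t = s − 1 for the scale s, so that the divisor suc t is never zero.
module QuotientSum (n : ℕ) (f : Fin n → ℕ) where

  quotientSum : ℕ → ℕ
  quotientSum t = sumFin n (λ i → f i / suc t)

  sumFin≤quotientSum₀ : sumFin n f ≤ quotientSum 0
  sumFin≤quotientSum₀ = sumFin-mono-≤ n (λ i → ≤-reflexive (sym (n/1≡n (f i))))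

  quotientSum*[1+t]≤sumFin : ∀ t → quotientSum t * suc t ≤ sumFin n f
  quotientSum*[1+t]≤sumFin t = begin
    quotientSum t * suc t                  ≡⟨ sumFin-distribʳ-* n (λ i → f i / suc t) (suc t) ⟨
    sumFin n (λ i → f i / suc t * suc t)   ≤⟨ sumFin-mono-≤ n (λ i → m/n*n≤m (f i) (suc t)) ⟩
    sumFin n f                             ∎
    where open ≤-Reasoning

  sumFin≤quotientSum*[1+t]+n*t : ∀ t → sumFin n f ≤ quotientSum t * suc t + n * t
  sumFin≤quotientSum*[1+t]+n*t t = begin
    sumFin n f                                   ≤⟨ sumFin-mono-≤ n (λ i → m≤[m/1+t]*[1+t]+t (f i) t) ⟩
    sumFin n (λ i → f i / suc t * suc t + t)     ≡⟨ sumFin-distrib-+ n (λ i → f i / suc t * suc t) (λ _ → t) ⟩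
    sumFin n (λ i → f i / suc t * suc t) + sumFin n (λ _ → t)
      ≡⟨ cong₂ _+_ (sumFin-distribʳ-* n (λ i → f i / suc t) (suc t)) (sumFin-const n t) ⟩
    quotientSum t * suc t + n * t                ∎
    where open ≤-Reasoning

  quotientSum-select : ∀ t k → k ≤ quotientSum t →
                       ∃ λ (σ : Fin n → ℕ) → (∀ i → σ i * suc t ≤ f i) × sumFin n σ ≡ k
  quotientSum-select t k k≤q with sumFin-select n (λ i → f i / suc t) k k≤q
  ... | σ , σ≤f/s , Σσ≡k =
    σ , (λ i → ≤-trans (*-monoˡ-≤ (suc t) (σ≤f/s i)) (m/n*n≤m (f i) (suc t))) , Σσ≡k

  maximal-scale : ∀ {k} → k > 0 → k ≤ quotientSum 0 →
                  ∃ λ t → k ≤ quotientSum t × quotientSum (suc t) < k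
  maximal-scale {k} k>0 k≤q₀
    with last-before-failure (λ t → k ≤? quotientSum t) k≤q₀ (sumFin n f) ¬k≤q[Σf]
    where
    ¬k≤q[Σf] : ¬ k ≤ quotientSum (sumFin n f)
    ¬k≤q[Σf] k≤q = <⇒≱ (≤-trans (m≤n*m (suc (sumFin n f)) k {{>-nonZero k>0}}) (*-monoˡ-≤ _ k≤q))
                       (quotientSum*[1+t]≤sumFin (sumFin n f))
  ... | t , k≤q[t] , ¬k≤q[1+t] = t , k≤q[t] , ≰⇒> ¬k≤q[1+t]

  deficit-bound : ∀ {k} t → k ≤ quotientSum t → quotientSum (suc t) < k →
                  (+ k) ℤ.* ((+ sumFin n f) ℤ.- (+ (suc t * k))) ℤ.≤ (+ (n * sumFin n f)) ℤ.+ (+ (k * k))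
  deficit-bound {k} t k≤q[t] q[1+t]<k = begin
    + k ℤ.* (+ sumFin n f ℤ.- + (s * k))   ≡⟨ +*[+-+]≡+[*∸] k sk≤Σf ⟩
    + (k * (sumFin n f ∸ s * k))           ≤⟨ ℤ.+≤+ (k*[S∸s*k]≤ℓ*S+k*k n k s _ sk≤Σf Σf≤k[1+s]+ns) ⟩
    + (n * sumFin n f + k * k)             ≡⟨ ℤ.pos-+ (n * sumFin n f) (k * k) ⟩
    + (n * sumFin n f) ℤ.+ + (k * k)       ∎
    where
    open ℤ.≤-Reasoning
    s : ℕ
    s = suc t
    sk≤Σf : s * k ≤ sumFin n f
    sk≤Σf = ≤-trans (≤-reflexive (*-comm s k)) (≤-trans (*-monoˡ-≤ s k≤q[t]) (quotientSum*[1+t]≤sumFin t))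
    Σf≤k[1+s]+ns : sumFin n f ≤ k * suc s + n * s
    Σf≤k[1+s]+ns = ≤-trans (sumFin≤quotientSum*[1+t]+n*t s)
                           (+-monoˡ-≤ (n * s) (*-monoˡ-≤ (suc s) (<⇒≤ q[1+t]<k)))

proposition3p13 : (ℓ k : ℕ) → ℓ > 0 → k > 0 → (sz : Fin ℓ → ℕ) → (∀ i → sz i > 0) →
    sumFin ℓ sz ≥ k + ℓ →
    Σ ℕ (λ s → Σ (Fin ℓ → ℕ) (λ σ →
    (s > 0) ×
    (∀ i → σ i * s ≤ sz i) ×
    (sumFin ℓ σ ≡ k) ×
    ((+ k) ℤ.* ((+ sumFin ℓ sz) ℤ.- (+ (s * k))) ℤ.≤ (+ (ℓ * sumFin ℓ sz)) ℤ.+ (+ (k * k)))))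
proposition3p13 ℓ k _ k>0 sz _ Σsz≥k+ℓ =
  let t , k≤q[t] , q[1+t]<k = maximal-scale k>0 k≤q₀
      σ , σs≤sz , Σσ≡k      = quotientSum-select t k k≤q[t]
  in suc t , σ , s≤s z≤n , σs≤sz , Σσ≡k , deficit-bound t k≤q[t] q[1+t]<k
  where
  open QuotientSum ℓ sz
  k≤q₀ : k ≤ quotientSum 0
  k≤q₀ = ≤-trans (≤-trans (m≤m+n k ℓ) Σsz≥k+ℓ) sumFin≤quotientSum₀
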